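{- For all formulas $\varphi,\psi$ of $\mathsf{QRC_1}$, if $\varphi\vdash\psi$ is derivable in $\mathsf{QRC_1}$, then $\mathrm{md}(\varphi)\ge\mathrm{md}(\psi)$.
   Context: Fix a countable set of variables. A signature $\Sigma$ is a set of constants and a set of relation symbols with arities (no function symbols). A term is a variable or a constant. Formulas are built from $\top$ and $S(t_0,\dots,t_{n-1})$ ($S$ $n$-ary, $t_i$ terms) by $\wedge$, the unary modality $\Diamond$, and $\forall x$. $\mathrm{fv}(\varphi)$ is the set of free variables; $\varphi[x\leftarrow t]$ is simultaneous replacement of free occurrences of $x$ by $t$; $t$ is free for $x$ in $\varphi$ if no variable of $t$ becomes bound in $\varphi[x\leftarrow t]$. $\mathsf{QRC_1}$ derives sequents $\varphi\vdash\psi$ by: (i) $\varphi\vdash\top$, $\varphi\vdash\varphi$; (ii) $\varphi\wedge\psi\vdash\varphi$, $\varphi\wedge\psi\vdash\psi$; (iii) from $\varphi\vdash\psi$, $\varphi\vdash\chi$ infer $\varphi\vdash\psi\wedge\chi$; (iv) from $\varphi\vdash\psi$, $\psi\vdash\chi$ infer $\varphi\vdash\chi$; (v) from $\varphi\vdash\psi$ infer $\Diamond\varphi\vdash\Diamond\psi$; (vi) $\Diamond\Diamond\varphi\vdash\Diamond\varphi$; (vii) $\Diamond\forall x\varphi\vdash\forall x\Diamond\varphi$; (viii) from $\varphi\vdash\psi$ infer $\varphi\vdash\forall x\psi$ if $x\notin\mathrm{fv}(\varphi)$; (ix) from $\varphi[x\leftarrow t]\vdash\psi$ infer $\forall x\varphi\vdash\psi$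 if $t$ is free for $x$ in $\varphi$; (x) from $\varphi\vdash\psi$ infer $\varphi[x\leftarrow t]\vdash\psi[x\leftarrow t]$ if $t$ is free for $x$ in $\varphi$ and $\psi$; (xi) from $\varphi[x\leftarrow c]\vdash\psi[x\leftarrow c]$ infer $\varphi\vdash\psi$ if the constant $c$ occurs in neither $\varphi$ nor $\psi$. Modal depth: $\mathrm{md}(\top)=\mathrm{md}(S(t_0,\dots,t_{n-1}))=0$; $\mathrm{md}(\psi\wedge\chi)=\max\{\mathrm{md}(\psi),\mathrm{md}(\chi)\}$; $\mathrm{md}(\forall x\psi)=\mathrm{md}(\psi)$; $\mathrm{md}(\Diamond\psi)=\mathrm{md}(\psi)+1$. -}

module Defs where

open import Data.Nat using (ℕ; zero; suc; _⊔_; _≟_)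
open import Data.Vec using (Vec; map)
open import Data.Vec.Membership.Propositional using (_∈_)
open import Data.Empty using (⊥)
open import Relation.Nullary using (¬_; yes; no)
open import Relation.Binary.PropositionalEquality using (_≡_; _≢_)

record Signature : Set₁ where
  field
    Const : Set
    Rel   : Set
    arity : Rel → ℕ

Var : Set
Var = ℕ

module QRC (Σ : Signature) where
  open Signature Σ

  data Term : Set where
    var   : Var → Term
    const : Const → Term

  infixr 6 _∧_
  data Formula : Set where
    ⊤   : Formula
    rel : (S : Rel) → Vec Term (arity S) → Formula
    _∧_ : Formula → Formula → Formula
    ◇   : Formula → Formula
    ∀'  : Var → Formula → Formula

  md : Formula → ℕ
  md ⊤         = zero
  md (rel S ts) = zero
  md (φ ∧ ψ)   = md φ ⊔ md ψ
  md (◇ φ)     = suc (md φ)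
  md (∀' x φ)  = md φ

  data _∈varT_ (x : Var) : Term → Set where
    here : x ∈varT var x

  data _∈fv_ (x : Var) : Formula → Set where
    fv-rel : ∀ {S ts} (t : Term) → t ∈ ts → x ∈varT t → x ∈fv rel S ts
    fv-∧ˡ  : ∀ {φ ψ} → x ∈fv φ → x ∈fv (φ ∧ ψ)
    fv-∧ʳ  : ∀ {φ ψ} → x ∈fv ψ → x ∈fv (φ ∧ ψ)
    fv-◇   : ∀ {φ} → x ∈fv φ → x ∈fv ◇ φ
    fv-∀   : ∀ {y φ} → y ≢ x → x ∈fv φ → x ∈fv ∀' y φ

  data _∈constT_ (c : Const) : Term → Set where
    here : c ∈constT const c

  data _occursIn_ (c : Const) : Formula → Set where
    oc-rel : ∀ {S ts} (t : Term) → t ∈ ts → c ∈constT t → c occursIn rel S ts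
    oc-∧ˡ  : ∀ {φ ψ} → c occursIn φ → c occursIn (φ ∧ ψ)
    oc-∧ʳ  : ∀ {φ ψ} → c occursIn ψ → c occursIn (φ ∧ ψ)
    oc-◇   : ∀ {φ} → c occursIn φ → c occursIn ◇ φ
    oc-∀   : ∀ {y φ} → c occursIn φ → c occursIn ∀' y φ

  substT : Term → Var → Term → Term
  substT (var y)   x t with x ≟ y
  ... | yes _ = t
  ... | no  _ = var y
  substT (const c) x t = const c

  _[_←_] : Formula → Var → Term → Formula
  ⊤          [ x ← t ] = ⊤
  rel S ts   [ x ← t ] = rel S (map (λ u → substT u x t) ts)
  (φ ∧ ψ)    [ x ← t ] = (φ [ x ← t ]) ∧ (ψ [ x ← t ])
  ◇ φ        [ x ← t ] = ◇ (φ [ x ← t ])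
  ∀' y φ     [ x ← t ] with x ≟ y
  ... | yes _ = ∀' y φ
  ... | no  _ = ∀' y (φ [ x ← t ])

  data FreeFor (t : Term) (x : Var) : Formula → Set where
    ff-⊤     : FreeFor t x ⊤
    ff-rel   : ∀ {S ts} → FreeFor t x (rel S ts)
    ff-∧     : ∀ {φ ψ} → FreeFor t x φ → FreeFor t x ψ → FreeFor t x (φ ∧ ψ)
    ff-◇     : ∀ {φ} → FreeFor t x φ → FreeFor t x (◇ φ)
    ff-∀nf   : ∀ {y φ} → ¬ (x ∈fv ∀' y φ) → FreeFor t x (∀' y φ)
    ff-∀     : ∀ {y φ} → ¬ (y ∈varT t) → FreeFor t x φ → FreeFor t x (∀' y φ)

  infix 4 _⊢_
  data _⊢_ : Formula → Formula → Set where
    top   : ∀ {φ} → φ ⊢ ⊤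
    refl' : ∀ {φ} → φ ⊢ φ
    ∧-elˡ : ∀ {φ ψ} → φ ∧ ψ ⊢ φ
    ∧-elʳ : ∀ {φ ψ} → φ ∧ ψ ⊢ ψ
    ∧-in  : ∀ {φ ψ χ} → φ ⊢ ψ → φ ⊢ χ → φ ⊢ ψ ∧ χ
    cut   : ∀ {φ ψ χ} → φ ⊢ ψ → ψ ⊢ χ → φ ⊢ χ
    nec   : ∀ {φ ψ} → φ ⊢ ψ → ◇ φ ⊢ ◇ ψ
    trans◇ : ∀ {φ} → ◇ (◇ φ) ⊢ ◇ φ
    ◇∀    : ∀ {x φ} → ◇ (∀' x φ) ⊢ ∀' x (◇ φ)
    ∀-in  : ∀ {φ ψ x} → ¬ (x ∈fv φ) → φ ⊢ ψ → φ ⊢ ∀' x ψ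
    ∀-el  : ∀ {φ ψ x t} → FreeFor t x φ → φ [ x ← t ] ⊢ ψ → ∀' x φ ⊢ ψ
    subst' : ∀ {φ ψ x t} → FreeFor t x φ → FreeFor t x ψ →
             φ ⊢ ψ → φ [ x ← t ] ⊢ ψ [ x ← t ]
    const-gen : ∀ {φ ψ x} (c : Const) → ¬ (c occursIn φ) → ¬ (c occursIn ψ) →
                φ [ x ← const c ] ⊢ ψ [ x ← const c ] → φ ⊢ ψ

-- Substitution only replaces terms, so it leaves the modal depth unchanged; with
-- that, each rule of QRC₁ visibly preserves md ψ ≤ md φ from its premises.
module Submission where

open import Defs
open import Data.Nat using (_≤_; suc; _⊔_; _≟_; s≤s; z≤n)
open import Data.Nat.Properties using (≤-refl; ≤-trans; m≤m⊔n; m≤n⊔m; ⊔-lub; n≤1+n)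
open import Relation.Nullary using (yes; no)
open import Relation.Binary.PropositionalEquality using (_≡_; refl; cong; cong₂; subst; subst₂; sym)

module _ (Σ : Signature) where
  open QRC Σ

  md-subst : ∀ φ x t → md (φ [ x ← t ]) ≡ md φ
  md-subst ⊤          x t = refl
  md-subst (rel S ts) x t = refl
  md-subst (φ ∧ ψ)    x t = cong₂ _⊔_ (md-subst φ x t) (md-subst ψ x t)
  md-subst (◇ φ)      x t = cong suc (md-subst φ x t)
  md-subst (∀' y φ)   x t with x ≟ y
  ... | yes _ = refl
  ... | no  _ = md-subst φ x t

  ⊢⇒md-≤ : ∀ {φ ψ} → φ ⊢ ψ → md ψ ≤ md φ
  ⊢⇒md-≤ top                 = z≤n
  ⊢⇒md-≤ refl'               = ≤-refl
  ⊢⇒md-≤ (∧-elˡ {φ} {ψ})     = m≤m⊔n (md φ) (md ψ)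
  ⊢⇒md-≤ (∧-elʳ {φ} {ψ})     = m≤n⊔m (md φ) (md ψ)
  ⊢⇒md-≤ (∧-in p q)          = ⊔-lub (⊢⇒md-≤ p) (⊢⇒md-≤ q)
  ⊢⇒md-≤ (cut p q)           = ≤-trans (⊢⇒md-≤ q) (⊢⇒md-≤ p)
  ⊢⇒md-≤ (nec p)             = s≤s (⊢⇒md-≤ p)
  ⊢⇒md-≤ trans◇              = n≤1+n _
  ⊢⇒md-≤ ◇∀                  = ≤-refl
  ⊢⇒md-≤ (∀-in _ p)          = ⊢⇒md-≤ p
  ⊢⇒md-≤ (∀-el {φ} {ψ} {x} {t} _ p) =
    subst (md ψ ≤_) (md-subst φ x t) (⊢⇒md-≤ p)
  ⊢⇒md-≤ (subst' {φ} {ψ} {x} {t} _ _ p) =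
    subst₂ _≤_ (sym (md-subst ψ x t)) (sym (md-subst φ x t)) (⊢⇒md-≤ p)
  ⊢⇒md-≤ (const-gen {φ} {ψ} {x} c _ _ p) =
    subst₂ _≤_ (md-subst ψ x (const c)) (md-subst φ x (const c)) (⊢⇒md-≤ p)

lemma2p4 : (Σ : Signature) → let open QRC Σ in
    ∀ {φ ψ : Formula} → φ ⊢ ψ → md ψ ≤ md φ
lemma2p4 = ⊢⇒md-≤
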